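{- Let $S\subseteq\mathbb{Z}^+$ and integers $n,k,r\ge0$. Then $L_{S,r}(n,k)$ equals the number of pairs $(\tilde{\boldsymbol{\ell}},a)$ such that: (1) $\tilde{\boldsymbol{\ell}}=(\tilde\ell_1,\dots,\tilde\ell_r)$ is an $r$-tuple of asterisk lists, each of size in $S-1=\{s-1:s\in S\}$; (2) $a=\{\ell_1,\dots,\ell_k\}$ is a set of $k$ non-empty lists, each of size in $S$; (3) the label sets of $\tilde\ell_1,\dots,\tilde\ell_r,\ell_1,\dots,\ell_k$ are pairwise disjoint with union $[n]$ (so the sizes sum to $n$).
   Context: For $S\subseteq\mathbb{Z}^+$ and integers $n,k,r\ge 0$, $L_{S,r}(n,k)$ is the number of partitions of $[n+r]$ into $k+r$ non-empty lists (linearly ordered blocks; the set of lists is unordered) such that every list has size in $S$ and the elements $1,\dots,r$ lie in distinct lists. A list on a finite set of labels is a linear arrangement of it. An asterisk list on a finite set $A$ of labels is a linear arrangement of $A\cup\{\ast\}$, where $\ast$ is an extra "ghost" symbol; equivalently an ordered pair $(\ell_1,\ell_2)$ of (possibly empty) lists with disjoint label sets whose union is $A$, written $\ell_1\ast\ell_2$. Its size is $|A|$ (the symbol $\ast$ is not counted). -}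

module Defs where

open import Level using (Level; _⊔_) renaming (suc to lsuc)
open import Data.Nat using (ℕ; zero; suc; _+_; _≤_; _<_; _<?_)
open import Data.Fin as Fin using (Fin; toℕ)
open import Data.List using (List; []; _∷_; length; concat; concatMap; filter; _++_; allFin)
open import Data.Vec as Vec using (Vec)
open import Data.Product using (_×_; _,_)
open import Data.Empty using (⊥)
open import Data.List.Relation.Unary.All using (All)
open import Data.Vec.Relation.Unary.All renaming (All to VAll) using ()
import Data.List
open import Data.List.Relation.Unary.Linked using (Linked)
open import Data.List.Relation.Binary.Permutation.Propositional using (_↭_)
open import Relation.Binary.PropositionalEquality using (_≡_)

-- A "list" on a set of labels drawn from Fin N is a List (Fin N) (a linear
-- arrangement; distinctness of labels is enforced globally by the
-- partition condition below).

-- An asterisk list ℓ₁ ∗ ℓ₂ : an ordered pair of (possibly empty) lists.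
AsteriskList : ℕ → Set
AsteriskList N = List (Fin N) × List (Fin N)

astSize : ∀ {N} → AsteriskList N → ℕ
astSize (l₁ , l₂) = length l₁ + length l₂

astLabels : ∀ {N} → AsteriskList N → List (Fin N)
astLabels (l₁ , l₂) = l₁ ++ l₂

-- Canonical representation of an (unordered) set of pairwise disjoint
-- non-empty lists: the lists are listed in strictly increasing order of
-- their first elements.
HeadLt : ∀ {N} → List (Fin N) → List (Fin N) → Set
HeadLt (x ∷ _) (y ∷ _) = x Fin.< y
HeadLt _ _ = ⊥

specials : ∀ {N} → ℕ → List (Fin N) → ℕ
specials r b = length (filter (λ x → toℕ x <? r) b)

-- L_{S,r}(n,k)-structures: partitions of [n+r] (= Fin (n + r); the labels
-- 1..r are the elements with toℕ < r) into k + r non-empty lists, each of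
-- size in S, with the labels 1..r in distinct lists.
record LPart {ℓ : Level} (S : ℕ → Set ℓ) (r n k : ℕ) : Set ℓ where
  constructor lpart
  field
    blocks      : List (List (Fin (n + r)))
    .count      : length blocks ≡ k + r
    .sizes      : All (λ b → 0 < length b × S (length b)) blocks
    .partition  : concat blocks ↭ allFin (n + r)
    .canonical  : Linked HeadLt blocks
    .separated  : All (λ b → specials r b ≤ 1) blocks

record Pairs {ℓ : Level} (S : ℕ → Set ℓ) (r n k : ℕ) : Set ℓ where
  constructor pair
  field
    stars       : Vec (AsteriskList n) r
    blocks      : List (List (Fin n))
    -- size of each asterisk list lies in S - 1 = { s - 1 : s ∈ S }
    .starSizes  : VAll (λ t → S (suc (astSize t))) stars
    .count      : length blocks ≡ k
    .sizes      : All (λ b → 0 < length b × S (length b)) blocks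
    .partition  : concat (Data.List.map astLabels (Vec.toList stars)) ++ concat blocks ↭ allFin n
    .canonical  : Linked HeadLt blocks

module Submission where

-- Realise [n + r] as Fin (n + r), the labels 1, …, r being those x with
-- toℕ x < r ("special"), and identify the remaining labels with Fin n by
-- subtracting r.  Given a partition, each special label i lies in a unique
-- list, which it cuts as ℓ₁ i ℓ₂; replacing i by the ghost symbol ∗ turns
-- that list into the asterisk list ℓ₁ ∗ ℓ₂, whose size is one less.  The
-- lists without special labels form the set a.  Conversely, substituting i
-- for ∗ in the i-th asterisk list recovers the special list.  Both structures
-- store their unordered families of lists sorted by first element, so the
-- inverse direction sorts the rebuilt lists, and a sorted list of disjoint
-- lists is determined by the multiset of its members.

open import Level using (Level)
open import Data.Nat as ℕ using (ℕ; suc; _+_; _<_; _≤_; _<?_)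
import Data.Nat.Properties as ℕP
open import Data.Fin as Fin using (Fin; toℕ; fromℕ<)
import Data.Fin.Properties as FinP
open import Data.Maybe using (Maybe; just; nothing)
open import Data.List as List using (List; []; _∷_; length; concat; filter; _++_; map; allFin; mapMaybe)
import Data.List.Properties as LP
open import Data.List.Relation.Unary.All as All using (All; []; _∷_)
import Data.List.Relation.Unary.All.Properties as AllP
open import Data.List.Relation.Unary.Any as Any using (Any; here; there)
open import Data.List.Relation.Unary.AllPairs as AP using (AllPairs; []; _∷_)
open import Data.List.Relation.Unary.Linked as Lk using (Linked)
import Data.List.Relation.Unary.Linked.Properties as LkP
open import Data.List.Relation.Unary.Unique.Propositional using (Unique)
import Data.List.Relation.Unary.Unique.Propositional.Properties as UP
open import Data.List.Membership.Propositional using (_∈_; _∉_; lose; find)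
import Data.List.Membership.Propositional.Properties as MP
open import Data.List.Membership.Propositional.Properties.WithK using (unique∧set⇒bag)
import Data.List.Membership.DecPropositional as DecMembership
open import Data.List.Relation.Binary.BagAndSetEquality using (∼bag⇒↭)
open import Data.List.Relation.Binary.Permutation.Propositional
import Data.List.Relation.Binary.Permutation.Propositional.Properties as PermP
import Data.List.Relation.Binary.Permutation.Setoid.Properties as SetoidPermP
open import Data.Vec as Vec using (Vec)
import Data.Vec.Properties as VecP
import Data.Vec.Relation.Unary.All.Properties as VAllP
import Data.Product.Properties as ProdP
open import Data.Product using (_×_; _,_; proj₁; proj₂; ∃)
open import Data.Sum using (inj₁; inj₂)
open import Data.Empty using (⊥; ⊥-elim)
open import Function using (_∘_)
open import Function.Bundles using (_↔_; mk↔ₛ′; mk⇔)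
open import Relation.Nullary using (¬_; Dec; yes; no; ¬?; contradiction)
open import Relation.Nullary.Decidable using (recompute)
open import Relation.Unary using (Pred; Decidable)
open import Relation.Binary.Core using (Rel)
open import Relation.Binary.Definitions using (DecidableEquality; Asymmetric)
open import Relation.Binary.PropositionalEquality as ≡
  using (_≡_; _≢_; refl; sym; cong; cong₂; subst; subst₂)
open import Defs

private variable
  a : Level
  A : Set a

-- Permutations and uniqueness

Unique-resp-↭ : {xs ys : List A} → xs ↭ ys → Unique xs → Unique ys
Unique-resp-↭ {A = A} p = SetoidPermP.Unique-resp-↭ (≡.setoid A) (↭⇒↭ₛ p)

unique-sameElements⇒↭ : {xs ys : List A} → Unique xs → Unique ys →
  (∀ {x} → x ∈ xs → x ∈ ys) → (∀ {x} → x ∈ ys → x ∈ xs) → xs ↭ ys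
unique-sameElements⇒↭ ux uy f g = ∼bag⇒↭ (unique∧set⇒bag ux uy (mk⇔ f g))

Unique-++⁻ʳ : (xs : List A) {ys : List A} → Unique (xs ++ ys) → Unique ys
Unique-++⁻ʳ [] u = u
Unique-++⁻ʳ (x ∷ xs) (_ ∷ u) = Unique-++⁻ʳ xs u

Unique-++⇒disjoint : (xs : List A) {ys : List A} → Unique (xs ++ ys) →
  ∀ {v} → v ∈ xs → v ∉ ys
Unique-++⇒disjoint (x ∷ xs) (x∉ ∷ u) (here refl) v∈ys = All.lookup x∉ (MP.∈-++⁺ʳ xs v∈ys) refl
Unique-++⇒disjoint (x ∷ xs) (_ ∷ u) (there v∈xs) v∈ys = Unique-++⇒disjoint xs u v∈xs v∈ys

concat-↭ : {xss yss : List (List A)} → xss ↭ yss → concat xss ↭ concat yss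
concat-↭ refl = refl
concat-↭ (prep xs p) = PermP.++⁺ˡ xs (concat-↭ p)
concat-↭ (swap xs ys p) = ↭-trans (PermP.shifts xs ys) (PermP.++⁺ˡ ys (PermP.++⁺ˡ xs (concat-↭ p)))
concat-↭ (trans p q) = ↭-trans (concat-↭ p) (concat-↭ q)

filter-++-filter-∁-↭ : {P : Pred A a} (P? : Decidable P) (xs : List A) →
  filter P? xs ++ filter (λ x → ¬? (P? x)) xs ↭ xs
filter-++-filter-∁-↭ P? [] = refl
filter-++-filter-∁-↭ P? (x ∷ xs) with P? x
... | yes _ = prep x (filter-++-filter-∁-↭ P? xs)
... | no _ = ↭-trans (PermP.shift x (filter P? xs) _) (prep x (filter-++-filter-∁-↭ P? xs))

shared-element⇒same-block : {B : List (List A)} → Unique (concat B) →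
  ∀ {x b c} → b ∈ B → c ∈ B → x ∈ b → x ∈ c → b ≡ c
shared-element⇒same-block {B = d ∷ B} u (here refl) (here refl) _ _ = refl
shared-element⇒same-block {B = d ∷ B} u (here refl) (there c∈B) x∈b x∈c =
  ⊥-elim (Unique-++⇒disjoint d u x∈b (MP.∈-concat⁺′ x∈c c∈B))
shared-element⇒same-block {B = d ∷ B} u (there b∈B) (here refl) x∈b x∈c =
  ⊥-elim (Unique-++⇒disjoint d u x∈c (MP.∈-concat⁺′ x∈b b∈B))
shared-element⇒same-block {B = d ∷ B} u (there b∈B) (there c∈B) x∈b x∈c =
  shared-element⇒same-block (Unique-++⁻ʳ d u) b∈B c∈B x∈b x∈c

AllPairs⇒Unique : ∀ {ℓ} {R : Rel A ℓ} → Asymmetric R → {xs : List A} → AllPairs R xs → Unique xs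
AllPairs⇒Unique asym = AP.map (λ { Rxy refl → asym Rxy Rxy })

AllPairs-↭⇒≡ : ∀ {ℓ} {R : Rel A ℓ} → Asymmetric R →
  {xs ys : List A} → AllPairs R xs → AllPairs R ys → xs ↭ ys → xs ≡ ys
AllPairs-↭⇒≡ asym {[]} {[]} _ _ _ = refl
AllPairs-↭⇒≡ asym {[]} {y ∷ ys} _ _ p = ⊥-elim (PermP.¬x∷xs↭[] (↭-sym p))
AllPairs-↭⇒≡ asym {x ∷ xs} {[]} _ _ p = ⊥-elim (PermP.¬x∷xs↭[] p)
AllPairs-↭⇒≡ asym {x ∷ xs} {y ∷ ys} (x< ∷ Rxs) (y< ∷ Rys) p with PermP.∈-resp-↭ p (here refl)
... | here refl = cong (x ∷_) (AllPairs-↭⇒≡ asym Rxs Rys (PermP.drop-∷ p))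
... | there x∈ys with PermP.∈-resp-↭ (↭-sym p) (here refl)
...   | here refl = ⊥-elim (asym (All.lookup y< x∈ys) (All.lookup y< x∈ys))
...   | there y∈xs = ⊥-elim (asym (All.lookup y< x∈ys) (All.lookup x< y∈xs))

module Cutting {a} {A : Set a} (_≟_ : DecidableEquality A) where
  open DecMembership _≟_ using (_∈?_)

  breakAt : A → List A → List A × List A
  breakAt x [] = [] , []
  breakAt x (y ∷ ys) with y ≟ x
  ... | yes _ = [] , ys
  ... | no _ = y ∷ proj₁ (breakAt x ys) , proj₂ (breakAt x ys)

  breakAt-reassemble : ∀ {x} b → x ∈ b → proj₁ (breakAt x b) ++ x ∷ proj₂ (breakAt x b) ≡ b
  breakAt-reassemble {x} (y ∷ ys) x∈ with y ≟ x
  ... | yes refl = refl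
  breakAt-reassemble {x} (y ∷ ys) (here refl) | no y≢x = contradiction refl y≢x
  breakAt-reassemble {x} (y ∷ ys) (there x∈) | no _ = cong (y ∷_) (breakAt-reassemble ys x∈)

  breakAt-++∷ : ∀ {x} p q → x ∉ p → breakAt x (p ++ x ∷ q) ≡ (p , q)
  breakAt-++∷ {x} [] q _ with x ≟ x
  ... | yes _ = refl
  ... | no x≢x = contradiction refl x≢x
  breakAt-++∷ {x} (y ∷ p) q x∉ with y ≟ x
  ... | yes refl = contradiction (here refl) x∉
  ... | no _ rewrite breakAt-++∷ p q (λ x∈ → x∉ (there x∈)) = refl

  blockOf : A → List (List A) → List A
  blockOf x [] = []
  blockOf x (b ∷ B) with x ∈? b
  ... | yes _ = b
  ... | no _ = blockOf x B

  blockOf-∈ : ∀ {x} B → x ∈ concat B → blockOf x B ∈ B × x ∈ blockOf x B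
  blockOf-∈ {x} (b ∷ B) x∈ with x ∈? b
  ... | yes x∈b = here refl , x∈b
  ... | no x∉b with MP.∈-++⁻ b x∈
  ...   | inj₁ x∈b = contradiction x∈b x∉b
  ...   | inj₂ x∈B = let (b∈ , x∈b′) = blockOf-∈ B x∈B in there b∈ , x∈b′

  blockOf-unique : ∀ {x b} B → Unique (concat B) → b ∈ B → x ∈ b → blockOf x B ≡ b
  blockOf-unique B u b∈ x∈ = let (b′∈ , x∈b′) = blockOf-∈ B (MP.∈-concat⁺′ x∈ b∈) in
    shared-element⇒same-block u b′∈ b∈ x∈b′ x∈

-- Sorting lists by their first elements

module HeadOrder {m : ℕ} where

  Block : Set
  Block = List (Fin m)

  NonEmpty : Block → Set
  NonEmpty b = 0 < length b

  key : Block → ℕ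
  key [] = 0
  key (x ∷ _) = toℕ x

  HeadLt-trans : {b c d : Block} → HeadLt b c → HeadLt c d → HeadLt b d
  HeadLt-trans {_ ∷ _} {_ ∷ _} {_ ∷ _} = ℕP.<-trans

  HeadLt-asym : Asymmetric (HeadLt {m})
  HeadLt-asym {_ ∷ _} {_ ∷ _} = ℕP.<-asym

  key<⇒HeadLt : {b c : Block} → NonEmpty b → NonEmpty c → key b < key c → HeadLt b c
  key<⇒HeadLt {_ ∷ _} {_ ∷ _} _ _ lt = lt

  insert : Block → List Block → List Block
  insert b [] = b ∷ []
  insert b (c ∷ cs) with key b <? key c
  ... | yes _ = b ∷ c ∷ cs
  ... | no _ = c ∷ insert b cs

  sortByHead : List Block → List Block
  sortByHead [] = []
  sortByHead (b ∷ bs) = insert b (sortByHead bs)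

  insert-↭ : (b : Block) (cs : List Block) → insert b cs ↭ b ∷ cs
  insert-↭ b [] = refl
  insert-↭ b (c ∷ cs) with key b <? key c
  ... | yes _ = refl
  ... | no _ = ↭-trans (prep c (insert-↭ b cs)) (swap c b refl)

  sortByHead-↭ : (bs : List Block) → sortByHead bs ↭ bs
  sortByHead-↭ [] = refl
  sortByHead-↭ (b ∷ bs) = ↭-trans (insert-↭ b (sortByHead bs)) (prep b (sortByHead-↭ bs))

  DistinctKeys : List Block → Set
  DistinctKeys = AllPairs (λ b c → key b ≢ key c)

  insert-sorted : (b : Block) (cs : List Block) → NonEmpty b → All NonEmpty cs →
    All (λ c → key b ≢ key c) cs → AllPairs HeadLt cs → AllPairs HeadLt (insert b cs)
  insert-sorted b [] _ _ _ _ = [] ∷ []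
  insert-sorted b (c ∷ cs) nb (nc ∷ ncs) (b≢c ∷ b≢cs) (c< ∷ sorted) with key b <? key c
  ... | yes lt = (b<c ∷ All.map (HeadLt-trans b<c) c<) ∷ c< ∷ sorted
    where b<c = key<⇒HeadLt nb nc lt
  ... | no ≮ = PermP.All-resp-↭ (↭-sym (insert-↭ b cs)) (c<b ∷ c<) ∷ insert-sorted b cs nb ncs b≢cs sorted
    where c<b = key<⇒HeadLt nc nb (ℕP.≤∧≢⇒< (ℕP.≮⇒≥ ≮) (λ e → b≢c (sym e)))

  sortByHead-sorted′ : (bs : List Block) → All NonEmpty bs → DistinctKeys bs →
    AllPairs HeadLt (sortByHead bs)
  sortByHead-sorted′ [] _ _ = []
  sortByHead-sorted′ (b ∷ bs) (nb ∷ nbs) (b≢bs ∷ distinct) =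
    insert-sorted b (sortByHead bs) nb (resp nbs) (resp b≢bs) (sortByHead-sorted′ bs nbs distinct)
    where
    resp : ∀ {p} {P : Pred Block p} → All P bs → All P (sortByHead bs)
    resp = PermP.All-resp-↭ (↭-sym (sortByHead-↭ bs))

  disjoint⇒DistinctKeys : (bs : List Block) → All NonEmpty bs → Unique (concat bs) → DistinctKeys bs
  disjoint⇒DistinctKeys [] _ _ = []
  disjoint⇒DistinctKeys (b@(x ∷ _) ∷ bs) (_ ∷ nbs) u =
    All.tabulate key≢ ∷ disjoint⇒DistinctKeys bs nbs (Unique-++⁻ʳ b u)
    where
    key≢ : ∀ {c} → c ∈ bs → key b ≢ key c
    key≢ {[]} c∈ _ = contradiction (All.lookup nbs c∈) λ ()
    key≢ {y ∷ _} c∈ e = Unique-++⇒disjoint b u (here refl)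
      (MP.∈-concat⁺′ (subst (_∈ _) (sym (FinP.toℕ-injective e)) (here refl)) c∈)

  sortByHead-sorted : (bs : List Block) → All NonEmpty bs → Unique (concat bs) →
    Linked HeadLt (sortByHead bs)
  sortByHead-sorted bs nbs u = LkP.AllPairs⇒Linked (sortByHead-sorted′ bs nbs (disjoint⇒DistinctKeys bs nbs u))

  sorted-↭⇒≡ : {bs cs : List Block} → Linked HeadLt bs → Linked HeadLt cs → bs ↭ cs → bs ≡ cs
  sorted-↭⇒≡ sbs scs =
    AllPairs-↭⇒≡ HeadLt-asym (LkP.Linked⇒AllPairs HeadLt-trans sbs) (LkP.Linked⇒AllPairs HeadLt-trans scs)

  sorted⇒Unique : {bs : List Block} → Linked HeadLt bs → Unique bs
  sorted⇒Unique sbs = AllPairs⇒Unique HeadLt-asym (LkP.Linked⇒AllPairs HeadLt-trans sbs)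

-- Special and ordinary labels

module Labels (n r : ℕ) where

  Label : Set
  Label = Fin (n + r)

  open Cutting (FinP._≟_ {n + r}) public

  IsSpecial : Label → Set
  IsSpecial x = toℕ x < r

  isSpecial? : Decidable IsSpecial
  isSpecial? x = toℕ x <? r

  NoSpecial : List Label → Set
  NoSpecial = All (λ x → ¬ IsSpecial x)

  special : Fin r → Label
  special i = fromℕ< (ℕP.<-≤-trans (FinP.toℕ<n i) (ℕP.m≤n+m r n))

  ordinary : Fin n → Label
  ordinary j = fromℕ< (ℕP.+-monoˡ-< r (FinP.toℕ<n j))

  toℕ-special : ∀ i → toℕ (special i) ≡ toℕ i
  toℕ-special i = FinP.toℕ-fromℕ< _

  toℕ-ordinary : ∀ j → toℕ (ordinary j) ≡ toℕ j + r
  toℕ-ordinary j = FinP.toℕ-fromℕ< _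

  special-isSpecial : ∀ i → IsSpecial (special i)
  special-isSpecial i = subst (_< r) (sym (toℕ-special i)) (FinP.toℕ<n i)

  ordinary-¬isSpecial : ∀ j → ¬ IsSpecial (ordinary j)
  ordinary-¬isSpecial j s =
    ℕP.<-irrefl refl (ℕP.≤-<-trans (ℕP.m≤n+m r (toℕ j)) (subst (_< r) (toℕ-ordinary j) s))

  special≢ordinary : ∀ i j → special i ≢ ordinary j
  special≢ordinary i j e = ordinary-¬isSpecial j (subst IsSpecial e (special-isSpecial i))

  special-injective : ∀ {i i′} → special i ≡ special i′ → i ≡ i′
  special-injective {i} {i′} e = FinP.toℕ-injective
    (≡.trans (sym (toℕ-special i)) (≡.trans (cong toℕ e) (toℕ-special i′)))

  ordinary-injective : ∀ {j j′} → ordinary j ≡ ordinary j′ → j ≡ j′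
  ordinary-injective {j} {j′} e = FinP.toℕ-injective (ℕP.+-cancelʳ-≡ r _ _
    (≡.trans (sym (toℕ-ordinary j)) (≡.trans (cong toℕ e) (toℕ-ordinary j′))))

  isSpecial⇒special : ∀ x → IsSpecial x → ∃ λ i → special i ≡ x
  isSpecial⇒special x s = fromℕ< s , FinP.toℕ-injective (≡.trans (toℕ-special _) (FinP.toℕ-fromℕ< s))

  unshift : (x : Label) → ¬ IsSpecial x → Fin n
  unshift x ¬s = fromℕ< (ℕP.+-cancelʳ-< r _ n
    (subst (_< n + r) (sym (ℕP.m∸n+n≡m (ℕP.≮⇒≥ ¬s))) (FinP.toℕ<n x)))

  ordinary-unshift : ∀ x ¬s → ordinary (unshift x ¬s) ≡ x
  ordinary-unshift x ¬s = FinP.toℕ-injective (≡.trans (toℕ-ordinary _)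
    (≡.trans (cong (_+ r) (FinP.toℕ-fromℕ< _)) (ℕP.m∸n+n≡m (ℕP.≮⇒≥ ¬s))))

  allFin-↭-specials++ordinaries : allFin (n + r) ↭ map special (allFin r) ++ map ordinary (allFin n)
  allFin-↭-specials++ordinaries = unique-sameElements⇒↭ (UP.allFin⁺ (n + r))
    (UP.++⁺ (UP.map⁺ special-injective (UP.allFin⁺ r)) (UP.map⁺ ordinary-injective (UP.allFin⁺ n)) disjoint)
    (λ {x} _ → covers x) (λ {x} _ → MP.∈-allFin x)
    where
    disjoint : ∀ {v} → v ∈ map special (allFin r) × v ∈ map ordinary (allFin n) → ⊥
    disjoint (v∈s , v∈o) with MP.∈-map⁻ special v∈s | MP.∈-map⁻ ordinary v∈o
    ... | i , _ , e₁ | j , _ , e₂ = special≢ordinary i j (≡.trans (sym e₁) e₂)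
    covers : ∀ x → x ∈ map special (allFin r) ++ map ordinary (allFin n)
    covers x with isSpecial? x
    ... | yes s with isSpecial⇒special x s
    ...   | i , refl = MP.∈-++⁺ˡ (MP.∈-map⁺ special (MP.∈-allFin i))
    covers x | no ¬s = subst (_∈ _) (ordinary-unshift x ¬s)
      (MP.∈-++⁺ʳ (map special (allFin r)) (MP.∈-map⁺ ordinary (MP.∈-allFin _)))

  fromOrdinary : Label → Maybe (Fin n)
  fromOrdinary x with isSpecial? x
  ... | yes _ = nothing
  ... | no ¬s = just (unshift x ¬s)

  fromOrdinary-special : ∀ {x} → IsSpecial x → fromOrdinary x ≡ nothing
  fromOrdinary-special {x} s with isSpecial? x
  ... | yes _ = refl
  ... | no ¬s = contradiction s ¬s

  fromOrdinary-ordinary : ∀ j → fromOrdinary (ordinary j) ≡ just j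
  fromOrdinary-ordinary j with isSpecial? (ordinary j)
  ... | yes s = contradiction s (ordinary-¬isSpecial j)
  ... | no ¬s = cong just (ordinary-injective (ordinary-unshift (ordinary j) ¬s))

  ordinaries : List Label → List (Fin n)
  ordinaries = mapMaybe fromOrdinary

  ordinaries-++ : ∀ xs ys → ordinaries (xs ++ ys) ≡ ordinaries xs ++ ordinaries ys
  ordinaries-++ = LP.mapMaybe-++ fromOrdinary

  ordinaries-concat : ∀ xss → ordinaries (concat xss) ≡ concat (map ordinaries xss)
  ordinaries-concat [] = refl
  ordinaries-concat (xs ∷ xss) =
    ≡.trans (ordinaries-++ xs (concat xss)) (cong (ordinaries xs ++_) (ordinaries-concat xss))

  ordinaries-↭ : ∀ {xs ys} → xs ↭ ys → ordinaries xs ↭ ordinaries ys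
  ordinaries-↭ = PermP.mapMaybe-↭ fromOrdinary

  ordinaries-map-ordinary : ∀ l → ordinaries (map ordinary l) ≡ l
  ordinaries-map-ordinary = LP.mapMaybe-map-retract fromOrdinary-ordinary

  ordinaries-map-special : ∀ l → ordinaries (map special l) ≡ []
  ordinaries-map-special = LP.mapMaybe-map-none (λ i → fromOrdinary-special (special-isSpecial i))

  ordinaries-special∷ : ∀ i l → ordinaries (special i ∷ l) ≡ ordinaries l
  ordinaries-special∷ i l rewrite fromOrdinary-special (special-isSpecial i) = refl

  map-ordinary-ordinaries : ∀ {l} → NoSpecial l → map ordinary (ordinaries l) ≡ l
  map-ordinary-ordinaries {[]} [] = refl
  map-ordinary-ordinaries {x ∷ l} (¬s ∷ ¬ss) with isSpecial? x
  ... | yes s = contradiction s ¬s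
  ... | no ¬s′ = cong₂ _∷_ (ordinary-unshift x ¬s′) (map-ordinary-ordinaries ¬ss)

  length-ordinaries : ∀ {l} → NoSpecial l → length (ordinaries l) ≡ length l
  length-ordinaries {l} ns =
    ≡.trans (sym (LP.length-map ordinary (ordinaries l))) (cong length (map-ordinary-ordinaries ns))

  NoSpecial-map-ordinary : ∀ l → NoSpecial (map ordinary l)
  NoSpecial-map-ordinary l = AllP.map⁺ (All.universal ordinary-¬isSpecial l)

  ordinaries-allFin : ordinaries (allFin (n + r)) ↭ allFin n
  ordinaries-allFin = ↭-trans (ordinaries-↭ allFin-↭-specials++ordinaries) (↭-reflexive (begin
    ordinaries (map special (allFin r) ++ map ordinary (allFin n))
      ≡⟨ ordinaries-++ (map special (allFin r)) _ ⟩
    ordinaries (map special (allFin r)) ++ ordinaries (map ordinary (allFin n))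
      ≡⟨ cong₂ _++_ (ordinaries-map-special (allFin r)) (ordinaries-map-ordinary (allFin n)) ⟩
    allFin n ∎))
    where open ≡.≡-Reasoning

  HeadLt-map-ordinary⁺ : ∀ {u v} → HeadLt u v → HeadLt (map ordinary u) (map ordinary v)
  HeadLt-map-ordinary⁺ {x ∷ _} {y ∷ _} lt =
    subst₂ _<_ (sym (toℕ-ordinary x)) (sym (toℕ-ordinary y)) (ℕP.+-monoˡ-< r lt)

  HeadLt-map-ordinary⁻ : ∀ {u v} → HeadLt (map ordinary u) (map ordinary v) → HeadLt u v
  HeadLt-map-ordinary⁻ {x ∷ _} {y ∷ _} lt =
    ℕP.+-cancelʳ-< r _ _ (subst₂ _<_ (toℕ-ordinary x) (toℕ-ordinary y) lt)

  specials-special∷ : ∀ {x} l → IsSpecial x → specials r (x ∷ l) ≡ suc (specials r l)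
  specials-special∷ l s = cong length (LP.filter-accept isSpecial? s)

  specials-ordinary∷ : ∀ {x} l → ¬ IsSpecial x → specials r (x ∷ l) ≡ specials r l
  specials-ordinary∷ l ¬s = cong length (LP.filter-reject isSpecial? ¬s)

  NoSpecial⇒specials≡0 : ∀ {l} → NoSpecial l → specials r l ≡ 0
  NoSpecial⇒specials≡0 ns = cong length (LP.filter-none isSpecial? ns)

  specials≡0⇒NoSpecial : ∀ l → specials r l ≡ 0 → NoSpecial l
  specials≡0⇒NoSpecial [] _ = []
  specials≡0⇒NoSpecial (y ∷ l) e with isSpecial? y
  ... | yes s = contradiction (≡.trans (sym (specials-special∷ l s)) e) (λ ())
  ... | no ¬s = ¬s ∷ specials≡0⇒NoSpecial l (≡.trans (sym (specials-ordinary∷ l ¬s)) e)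

  specials≤1⇒NoSpecial-around : ∀ p {x} q → IsSpecial x → specials r (p ++ x ∷ q) ≤ 1 →
    NoSpecial p × NoSpecial q
  specials≤1⇒NoSpecial-around [] q s ≤1 =
    [] , specials≡0⇒NoSpecial q (ℕP.n≤0⇒n≡0 (ℕP.≤-pred (subst (_≤ 1) (specials-special∷ q s) ≤1)))
  specials≤1⇒NoSpecial-around (y ∷ p) {x} q s ≤1 with isSpecial? y
  ... | yes s′ = ⊥-elim (ℕP.<-irrefl refl (ℕP.≤-trans (ℕ.s≤s one≤) two≤))
    where
    one≤ = LP.filter-some isSpecial? (lose (MP.∈-++⁺ʳ p (here refl)) s)
    two≤ = subst (_≤ 1) (specials-special∷ (p ++ x ∷ q) s′) ≤1
  ... | no ¬s = let (nsp , nsq) = specials≤1⇒NoSpecial-around p q s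
                                    (subst (_≤ 1) (specials-ordinary∷ (p ++ x ∷ q) ¬s) ≤1)
                in ¬s ∷ nsp , nsq

  hasSpecial? : Decidable (Any IsSpecial)
  hasSpecial? b = Any.any? isSpecial? b

  noSpecial? : Decidable (λ b → ¬ Any IsSpecial b)
  noSpecial? b = ¬? (hasSpecial? b)

  starBlock : Fin r → AsteriskList n → List Label
  starBlock i (ℓ₁ , ℓ₂) = map ordinary ℓ₁ ++ special i ∷ map ordinary ℓ₂

  unstar : Fin r → List Label → AsteriskList n
  unstar i b = ordinaries (proj₁ (breakAt (special i) b)) , ordinaries (proj₂ (breakAt (special i) b))

  special-∈-starBlock : ∀ i t → special i ∈ starBlock i t
  special-∈-starBlock i (ℓ₁ , _) = MP.∈-++⁺ʳ (map ordinary ℓ₁) (here refl)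

  length-starBlock : ∀ i t → length (starBlock i t) ≡ suc (astSize t)
  length-starBlock i (ℓ₁ , ℓ₂) = begin
    length (map ordinary ℓ₁ ++ special i ∷ map ordinary ℓ₂)
      ≡⟨ LP.length-++ (map ordinary ℓ₁) ⟩
    length (map ordinary ℓ₁) + suc (length (map ordinary ℓ₂))
      ≡⟨ ℕP.+-suc (length (map ordinary ℓ₁)) _ ⟩
    suc (length (map ordinary ℓ₁) + length (map ordinary ℓ₂))
      ≡⟨ cong suc (cong₂ _+_ (LP.length-map ordinary ℓ₁) (LP.length-map ordinary ℓ₂)) ⟩
    suc (length ℓ₁ + length ℓ₂) ∎
    where open ≡.≡-Reasoning

  specials-starBlock : ∀ i t → specials r (starBlock i t) ≡ 1
  specials-starBlock i (ℓ₁ , ℓ₂) = begin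
    length (filter isSpecial? (map ordinary ℓ₁ ++ special i ∷ map ordinary ℓ₂))
      ≡⟨ cong length (LP.filter-++ isSpecial? (map ordinary ℓ₁) _) ⟩
    length (filter isSpecial? (map ordinary ℓ₁) ++ filter isSpecial? (special i ∷ map ordinary ℓ₂))
      ≡⟨ LP.length-++ (filter isSpecial? (map ordinary ℓ₁)) ⟩
    specials r (map ordinary ℓ₁) + specials r (special i ∷ map ordinary ℓ₂)
      ≡⟨ cong₂ _+_ (NoSpecial⇒specials≡0 (NoSpecial-map-ordinary ℓ₁))
                   (specials-special∷ (map ordinary ℓ₂) (special-isSpecial i)) ⟩
    suc (specials r (map ordinary ℓ₂))
      ≡⟨ cong suc (NoSpecial⇒specials≡0 (NoSpecial-map-ordinary ℓ₂)) ⟩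
    1 ∎
    where open ≡.≡-Reasoning

  unstar-starBlock : ∀ i t → unstar i (starBlock i t) ≡ t
  unstar-starBlock i (ℓ₁ , ℓ₂) = begin
    unstar i (starBlock i (ℓ₁ , ℓ₂))
      ≡⟨ cong (λ p → ordinaries (proj₁ p) , ordinaries (proj₂ p))
              (breakAt-++∷ (map ordinary ℓ₁) (map ordinary ℓ₂) special∉) ⟩
    ordinaries (map ordinary ℓ₁) , ordinaries (map ordinary ℓ₂)
      ≡⟨ cong₂ _,_ (ordinaries-map-ordinary ℓ₁) (ordinaries-map-ordinary ℓ₂) ⟩
    ℓ₁ , ℓ₂ ∎
    where
    open ≡.≡-Reasoning
    special∉ : special i ∉ map ordinary ℓ₁
    special∉ i∈ with MP.∈-map⁻ ordinary i∈
    ... | j , _ , e = special≢ordinary i j e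

  concat-starBlocks-↭ : (σ : Fin r → AsteriskList n) (is : List (Fin r)) →
    concat (map (λ i → starBlock i (σ i)) is) ↭ map special is ++ map ordinary (concat (map astLabels (map σ is)))
  concat-starBlocks-↭ σ [] = refl
  concat-starBlocks-↭ σ (i ∷ is) = begin
    (P ++ special i ∷ Q) ++ R
      ≡⟨ LP.++-assoc P (special i ∷ Q) R ⟩
    P ++ special i ∷ (Q ++ R)
      ↭⟨ PermP.shift (special i) P (Q ++ R) ⟩
    special i ∷ (P ++ Q ++ R)
      ↭⟨ prep (special i) (PermP.++⁺ˡ P (PermP.++⁺ˡ Q (concat-starBlocks-↭ σ is))) ⟩
    special i ∷ (P ++ Q ++ E ++ O)
      ≡⟨ cong (special i ∷_) (sym (LP.++-assoc P Q (E ++ O))) ⟩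
    special i ∷ ((P ++ Q) ++ E ++ O)
      ↭⟨ prep (special i) (PermP.shifts (P ++ Q) E) ⟩
    special i ∷ (E ++ (P ++ Q) ++ O)
      ≡⟨ cong (λ z → special i ∷ (E ++ z)) (≡.trans (cong (_++ O) (sym (LP.map-++ ordinary ℓ₁ ℓ₂)))
                                                    (sym (LP.map-++ ordinary (ℓ₁ ++ ℓ₂) rest))) ⟩
    special i ∷ (E ++ map ordinary ((ℓ₁ ++ ℓ₂) ++ rest)) ∎
    where
    open PermutationReasoning
    ℓ₁ = proj₁ (σ i)
    ℓ₂ = proj₂ (σ i)
    rest = concat (map astLabels (map σ is))
    P = map ordinary ℓ₁
    Q = map ordinary ℓ₂
    R = concat (map (λ i → starBlock i (σ i)) is)
    E = map special is
    O = map ordinary rest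

-- From a partition to a pair

length-map-allFin : ∀ {m} (f : Fin m → A) → length (map f (allFin m)) ≡ m
length-map-allFin f = ≡.trans (LP.length-map f (allFin _)) (LP.length-tabulate (λ i → i))

toList-tabulate : ∀ {m} (f : Fin m → A) → Vec.toList (Vec.tabulate f) ≡ map f (allFin m)
toList-tabulate f = ≡.trans (toList-tabulate′ f) (sym (LP.map-tabulate (λ i → i) f))
  where
  toList-tabulate′ : ∀ {m} (f : Fin m → A) → Vec.toList (Vec.tabulate f) ≡ List.tabulate f
  toList-tabulate′ {m = ℕ.zero} f = refl
  toList-tabulate′ {m = suc m} f = cong (f Fin.zero ∷_) (toList-tabulate′ (λ i → f (Fin.suc i)))

toList≡map-lookup-allFin : ∀ {m} (v : Vec A m) → Vec.toList v ≡ map (Vec.lookup v) (allFin m)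
toList≡map-lookup-allFin v = ≡.trans (cong Vec.toList (sym (VecP.tabulate∘lookup v))) (toList-tabulate (Vec.lookup v))

LabelPartition : ∀ {n} → List (AsteriskList n) → List (List (Fin n)) → Set
LabelPartition {n} ts A = concat (map astLabels ts) ++ concat A ↭ allFin n

SizeIn : ∀ {ℓ} → (ℕ → Set ℓ) → List A → Set ℓ
SizeIn S b = 0 < length b × S (length b)

module FromPartition (n r : ℕ) (B : List (List (Fin (n + r)))) where
  open Labels n r

  specialBlock : Fin r → List Label
  specialBlock i = blockOf (special i) B

  before after : Fin r → List Label
  before i = proj₁ (breakAt (special i) (specialBlock i))
  after i = proj₂ (breakAt (special i) (specialBlock i))

  starOf : Fin r → AsteriskList n
  starOf i = unstar i (specialBlock i)

  plain : List (List Label)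
  plain = filter noSpecial? B

  plainBlocks : List (List (Fin n))
  plainBlocks = map ordinaries plain

  plain-NoSpecial : ∀ {b} → b ∈ plain → NoSpecial b
  plain-NoSpecial {b} b∈ = AllP.¬Any⇒All¬ b (proj₂ (MP.∈-filter⁻ noSpecial? {xs = B} b∈))

  map-ordinary-plainBlocks : map (map ordinary) plainBlocks ≡ plain
  map-ordinary-plainBlocks = ≡.trans (sym (LP.map-∘ plain))
    (LP.map-id-local (All.tabulate (λ b∈ → map-ordinary-ordinaries (plain-NoSpecial b∈))))

  plainBlocks-sizes : ∀ {ℓ} (S : ℕ → Set ℓ) → All (SizeIn S) B → All (SizeIn S) plainBlocks
  plainBlocks-sizes S sizes = AllP.map⁺ (All.tabulate λ {b} b∈ →
    subst (λ m → 0 < m × S m) (sym (length-ordinaries (plain-NoSpecial b∈)))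
          (All.lookup sizes (proj₁ (MP.∈-filter⁻ noSpecial? {xs = B} b∈))))

  module Valid (partition : concat B ↭ allFin (n + r)) (canonical : Linked HeadLt B)
               (separated : All (λ b → specials r b ≤ 1) B) where

    unique : Unique (concat B)
    unique = Unique-resp-↭ (↭-sym partition) (UP.allFin⁺ (n + r))

    specialBlock-∈ : ∀ i → specialBlock i ∈ B
    specialBlock-∈ i = proj₁ (blockOf-∈ B (PermP.∈-resp-↭ (↭-sym partition) (MP.∈-allFin (special i))))

    special-∈-specialBlock : ∀ i → special i ∈ specialBlock i
    special-∈-specialBlock i = proj₂ (blockOf-∈ B (PermP.∈-resp-↭ (↭-sym partition) (MP.∈-allFin (special i))))

    specialBlock-reassemble : ∀ i → before i ++ special i ∷ after i ≡ specialBlock i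
    specialBlock-reassemble i = breakAt-reassemble (specialBlock i) (special-∈-specialBlock i)

    around-NoSpecial : ∀ i → NoSpecial (before i) × NoSpecial (after i)
    around-NoSpecial i = specials≤1⇒NoSpecial-around (before i) (after i) (special-isSpecial i)
      (subst (λ b → specials r b ≤ 1) (sym (specialBlock-reassemble i)) (All.lookup separated (specialBlock-∈ i)))

    starBlock-starOf : ∀ i → starBlock i (starOf i) ≡ specialBlock i
    starBlock-starOf i = ≡.trans
      (cong₂ (λ p q → p ++ special i ∷ q) (map-ordinary-ordinaries (proj₁ (around-NoSpecial i)))
                                          (map-ordinary-ordinaries (proj₂ (around-NoSpecial i))))
      (specialBlock-reassemble i)

    specialBlock-special : ∀ i {x} → x ∈ specialBlock i → IsSpecial x → x ≡ special i
    specialBlock-special i {x} x∈ s with MP.∈-++⁻ (before i) (subst (x ∈_) (sym (specialBlock-reassemble i)) x∈)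
    ... | inj₁ x∈before = contradiction s (All.lookup (proj₁ (around-NoSpecial i)) x∈before)
    ... | inj₂ (here x≡) = x≡
    ... | inj₂ (there x∈after) = contradiction s (All.lookup (proj₂ (around-NoSpecial i)) x∈after)

    specialBlock-injective : ∀ {i i′} → specialBlock i ≡ specialBlock i′ → i ≡ i′
    specialBlock-injective {i} {i′} e = special-injective
      (specialBlock-special i′ (subst (special i ∈_) e (special-∈-specialBlock i)) (special-isSpecial i))

    specialBlocks-↭ : filter hasSpecial? B ↭ map specialBlock (allFin r)
    specialBlocks-↭ = unique-sameElements⇒↭
      (UP.filter⁺ hasSpecial? (HeadOrder.sorted⇒Unique canonical))
      (UP.map⁺ specialBlock-injective (UP.allFin⁺ r)) ⊆ ⊇
      where
      ⊆ : ∀ {b} → b ∈ filter hasSpecial? B → b ∈ map specialBlock (allFin r)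
      ⊆ {b} b∈ with MP.∈-filter⁻ hasSpecial? b∈
      ... | b∈B , hasS with find hasS
      ...   | x , x∈b , s with isSpecial⇒special x s
      ...     | i , refl =
        subst (_∈ _) (blockOf-unique B unique b∈B x∈b) (MP.∈-map⁺ specialBlock (MP.∈-allFin i))
      ⊇ : ∀ {b} → b ∈ map specialBlock (allFin r) → b ∈ filter hasSpecial? B
      ⊇ b∈ with MP.∈-map⁻ specialBlock b∈
      ... | i , _ , refl =
        MP.∈-filter⁺ hasSpecial? (specialBlock-∈ i) (lose (special-∈-specialBlock i) (special-isSpecial i))

    specialBlocks++plain-↭ : map specialBlock (allFin r) ++ plain ↭ B
    specialBlocks++plain-↭ =
      ↭-trans (PermP.++⁺ʳ plain (↭-sym specialBlocks-↭)) (filter-++-filter-∁-↭ hasSpecial? B)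

    length-B : length B ≡ r + length plainBlocks
    length-B = begin
      length B                                            ≡⟨ PermP.↭-length specialBlocks++plain-↭ ⟨
      length (map specialBlock (allFin r) ++ plain)       ≡⟨ LP.length-++ (map specialBlock (allFin r)) ⟩
      length (map specialBlock (allFin r)) + length plain ≡⟨ cong₂ _+_ (length-map-allFin specialBlock)
                                                                       (sym (LP.length-map ordinaries plain)) ⟩
      r + length plainBlocks                              ∎
      where open ≡.≡-Reasoning

    plainBlocks-count : ∀ {k} → length B ≡ k + r → length plainBlocks ≡ k
    plainBlocks-count {k} count =
      ℕP.+-cancelʳ-≡ r _ _ (≡.trans (ℕP.+-comm (length plainBlocks) r) (≡.trans (sym length-B) count))

    astLabels-starOf : ∀ i → astLabels (starOf i) ≡ ordinaries (specialBlock i)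
    astLabels-starOf i = begin
      ordinaries (before i) ++ ordinaries (after i)
        ≡⟨ cong (ordinaries (before i) ++_) (sym (ordinaries-special∷ i (after i))) ⟩
      ordinaries (before i) ++ ordinaries (special i ∷ after i)
        ≡⟨ sym (ordinaries-++ (before i) _) ⟩
      ordinaries (before i ++ special i ∷ after i)
        ≡⟨ cong ordinaries (specialBlock-reassemble i) ⟩
      ordinaries (specialBlock i) ∎
      where open ≡.≡-Reasoning

    stars-partition : LabelPartition (map starOf (allFin r)) plainBlocks
    stars-partition = begin
      concat (map astLabels (map starOf (allFin r))) ++ concat plainBlocks
        ≡⟨ cong (λ ls → concat ls ++ concat plainBlocks) starLabels ⟩
      concat (map ordinaries (map specialBlock (allFin r))) ++ concat (map ordinaries plain)
        ≡⟨ ≡.trans (LP.concat-++ (map ordinaries (map specialBlock (allFin r))) _)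
                   (cong concat (sym (LP.map-++ ordinaries (map specialBlock (allFin r)) plain))) ⟩
      concat (map ordinaries (map specialBlock (allFin r) ++ plain))
        ≡⟨ sym (ordinaries-concat (map specialBlock (allFin r) ++ plain)) ⟩
      ordinaries (concat (map specialBlock (allFin r) ++ plain))
        ↭⟨ ordinaries-↭ (concat-↭ specialBlocks++plain-↭) ⟩
      ordinaries (concat B)
        ↭⟨ ordinaries-↭ partition ⟩
      ordinaries (allFin (n + r))
        ↭⟨ ordinaries-allFin ⟩
      allFin n ∎
      where
      open PermutationReasoning
      starLabels : map astLabels (map starOf (allFin r)) ≡ map ordinaries (map specialBlock (allFin r))
      starLabels = ≡.trans (sym (LP.map-∘ (allFin r)))
                   (≡.trans (LP.map-cong astLabels-starOf (allFin r)) (LP.map-∘ (allFin r)))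

    plainBlocks-canonical : Linked HeadLt plainBlocks
    plainBlocks-canonical = Lk.map HeadLt-map-ordinary⁻ (LkP.map⁻ (subst (Linked HeadLt) (sym map-ordinary-plainBlocks)
      (LkP.filter⁺ noSpecial? HeadOrder.HeadLt-trans canonical)))

    stars-sizes : ∀ {ℓ} (S : ℕ → Set ℓ) → All (SizeIn S) B → ∀ i → S (suc (astSize (starOf i)))
    stars-sizes S sizes i = subst S
      (≡.trans (cong length (sym (starBlock-starOf i))) (length-starBlock i (starOf i)))
      (proj₂ (All.lookup sizes (specialBlock-∈ i)))

-- From a pair to a partition

module FromPairs (n r : ℕ) (σ : Fin r → AsteriskList n) (A : List (List (Fin n))) where
  open Labels n r
  open HeadOrder using (NonEmpty; sortByHead; sortByHead-↭; sortByHead-sorted)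

  starBlocks : List (List Label)
  starBlocks = map (λ i → starBlock i (σ i)) (allFin r)

  unsorted : List (List Label)
  unsorted = starBlocks ++ map (map ordinary) A

  blocks : List (List Label)
  blocks = sortByHead unsorted

  module _ {p} {P : Pred (List Label) p} (Pstar : ∀ i → P (starBlock i (σ i)))
           (PA : All (λ b → P (map ordinary b)) A) where

    All-unsorted : All P unsorted
    All-unsorted = AllP.++⁺ (AllP.map⁺ (All.universal Pstar (allFin r))) (AllP.map⁺ PA)

    All-blocks : All P blocks
    All-blocks = PermP.All-resp-↭ (↭-sym (sortByHead-↭ unsorted)) All-unsorted

  blocks-separated : All (λ b → specials r b ≤ 1) blocks
  blocks-separated = All-blocks (λ i → ℕP.≤-reflexive (specials-starBlock i (σ i)))
    (All.universal (λ b → subst (_≤ 1) (sym (NoSpecial⇒specials≡0 (NoSpecial-map-ordinary b))) ℕ.z≤n) A)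

  blocks-sizes : ∀ {ℓ} (S : ℕ → Set ℓ) → (∀ i → S (suc (astSize (σ i)))) →
    All (SizeIn S) A → All (SizeIn S) blocks
  blocks-sizes S starSizes sizes = All-blocks
    (λ i → subst (λ m → 0 < m × S m) (sym (length-starBlock i (σ i))) (ℕ.s≤s ℕ.z≤n , starSizes i))
    (All.map (λ {b} → subst (λ m → 0 < m × S m) (sym (LP.length-map ordinary b))) sizes)

  blocks-count : length blocks ≡ length A + r
  blocks-count = begin
    length blocks
      ≡⟨ PermP.↭-length (sortByHead-↭ unsorted) ⟩
    length unsorted
      ≡⟨ LP.length-++ starBlocks ⟩
    length starBlocks + length (map (map ordinary) A)
      ≡⟨ cong₂ _+_ (length-map-allFin _) (LP.length-map (map ordinary) A) ⟩
    r + length A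
      ≡⟨ ℕP.+-comm r (length A) ⟩
    length A + r ∎
    where open ≡.≡-Reasoning

  module Valid (partition : LabelPartition (map σ (allFin r)) A)
               (nonEmpty : All NonEmpty A) where

    unsorted-partition : concat unsorted ↭ allFin (n + r)
    unsorted-partition = begin
      concat unsorted
        ≡⟨ sym (LP.concat-++ starBlocks (map (map ordinary) A)) ⟩
      concat starBlocks ++ concat (map (map ordinary) A)
        ≡⟨ cong (concat starBlocks ++_) (LP.concat-map A) ⟩
      concat starBlocks ++ map ordinary (concat A)
        ↭⟨ PermP.++⁺ʳ _ (concat-starBlocks-↭ σ (allFin r)) ⟩
      (SP ++ map ordinary X) ++ map ordinary (concat A)
        ≡⟨ LP.++-assoc SP (map ordinary X) _ ⟩
      SP ++ map ordinary X ++ map ordinary (concat A)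
        ≡⟨ cong (SP ++_) (sym (LP.map-++ ordinary X (concat A))) ⟩
      SP ++ map ordinary (X ++ concat A)
        ↭⟨ PermP.++⁺ˡ SP (PermP.map⁺ ordinary partition) ⟩
      SP ++ map ordinary (allFin n)
        ↭⟨ ↭-sym allFin-↭-specials++ordinaries ⟩
      allFin (n + r) ∎
      where
      open PermutationReasoning
      X = concat (map astLabels (map σ (allFin r)))
      SP = map special (allFin r)

    blocks-partition : concat blocks ↭ allFin (n + r)
    blocks-partition = ↭-trans (concat-↭ (sortByHead-↭ unsorted)) unsorted-partition

    blocks-canonical : Linked HeadLt blocks
    blocks-canonical = sortByHead-sorted unsorted
      (All-unsorted (λ i → subst (0 <_) (sym (length-starBlock i (σ i))) (ℕ.s≤s ℕ.z≤n))
                    (All.map (λ {b} → subst (0 <_) (sym (LP.length-map ordinary b))) nonEmpty))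
      (Unique-resp-↭ (↭-sym unsorted-partition) (UP.allFin⁺ (n + r)))

-- The two constructions are mutually inverse

module PairsRoundTrip (n r : ℕ) (σ : Fin r → AsteriskList n) (A : List (List (Fin n)))
  (partition : LabelPartition (map σ (allFin r)) A) (nonEmpty : All HeadOrder.NonEmpty A)
  (canonical : Linked HeadLt A) where
  open Labels n r
  open HeadOrder using (HeadLt-trans; sortByHead-↭; sorted-↭⇒≡)
  open FromPairs n r σ A
  open Valid partition nonEmpty
  open FromPartition n r blocks using (starOf; plain; plainBlocks)

  starBlock-∈-blocks : ∀ i → starBlock i (σ i) ∈ blocks
  starBlock-∈-blocks i = PermP.∈-resp-↭ (↭-sym (sortByHead-↭ unsorted))
    (MP.∈-++⁺ˡ (MP.∈-map⁺ (λ i → starBlock i (σ i)) (MP.∈-allFin i)))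

  starOf-blocks : ∀ i → starOf i ≡ σ i
  starOf-blocks i = ≡.trans
    (cong (unstar i) (blockOf-unique blocks (Unique-resp-↭ (↭-sym blocks-partition) (UP.allFin⁺ (n + r)))
                                     (starBlock-∈-blocks i) (special-∈-starBlock i (σ i))))
    (unstar-starBlock i (σ i))

  plain-blocks : plain ≡ map (map ordinary) A
  plain-blocks = sorted-↭⇒≡ (LkP.filter⁺ noSpecial? HeadLt-trans blocks-canonical)
    (LkP.map⁺ (Lk.map HeadLt-map-ordinary⁺ canonical))
    (↭-trans (PermP.filter-↭ noSpecial? (sortByHead-↭ unsorted)) (↭-reflexive (begin
      filter noSpecial? (starBlocks ++ map (map ordinary) A)
        ≡⟨ LP.filter-++ noSpecial? starBlocks _ ⟩
      filter noSpecial? starBlocks ++ filter noSpecial? (map (map ordinary) A)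
        ≡⟨ cong₂ _++_ (LP.filter-none noSpecial? (AllP.map⁺ (All.universal starBlock-hasSpecial (allFin r))))
                      (LP.filter-all noSpecial? (AllP.map⁺ (All.universal ordinaryBlock-noSpecial A))) ⟩
      map (map ordinary) A ∎)))
    where
    open ≡.≡-Reasoning
    starBlock-hasSpecial : ∀ i → ¬ ¬ Any IsSpecial (starBlock i (σ i))
    starBlock-hasSpecial i noS = noS (lose (special-∈-starBlock i (σ i)) (special-isSpecial i))
    ordinaryBlock-noSpecial : ∀ b → ¬ Any IsSpecial (map ordinary b)
    ordinaryBlock-noSpecial b = AllP.All¬⇒¬Any (NoSpecial-map-ordinary b)

  plainBlocks-blocks : plainBlocks ≡ A
  plainBlocks-blocks = begin
    map ordinaries plain                ≡⟨ cong (map ordinaries) plain-blocks ⟩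
    map ordinaries (map (map ordinary) A) ≡⟨ sym (LP.map-∘ A) ⟩
    map (ordinaries ∘ map ordinary) A   ≡⟨ LP.map-cong ordinaries-map-ordinary A ⟩
    map (λ b → b) A                     ≡⟨ LP.map-id A ⟩
    A                                   ∎
    where open ≡.≡-Reasoning

module PartitionRoundTrip (n r : ℕ) (B : List (List (Fin (n + r))))
  (partition : concat B ↭ allFin (n + r)) (canonical : Linked HeadLt B) (separated : All (λ b → specials r b ≤ 1) B)
  (nonEmpty : All HeadOrder.NonEmpty B) where
  open Labels n r
  open HeadOrder using (sortByHead; sortByHead-↭; sortByHead-sorted; sorted-↭⇒≡)
  open FromPartition n r B
  open Valid partition canonical separated

  blocks-starOf : (σ : Fin r → AsteriskList n) → (∀ i → σ i ≡ starOf i) →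
    FromPairs.blocks n r σ plainBlocks ≡ B
  blocks-starOf σ σ≗starOf = begin
    sortByHead (map (λ i → starBlock i (σ i)) (allFin r) ++ map (map ordinary) plainBlocks)
      ≡⟨ cong sortByHead (cong₂ _++_ (LP.map-cong starBlock-σ (allFin r)) map-ordinary-plainBlocks) ⟩
    sortByHead (map specialBlock (allFin r) ++ plain)
      ≡⟨ sorted-↭⇒≡ (sortByHead-sorted _ (PermP.All-resp-↭ (↭-sym specialBlocks++plain-↭) nonEmpty)
                                         (Unique-resp-↭ (concat-↭ (↭-sym specialBlocks++plain-↭)) unique))
                    canonical (↭-trans (sortByHead-↭ _) specialBlocks++plain-↭) ⟩
    B ∎
    where
    open ≡.≡-Reasoning
    starBlock-σ : ∀ i → starBlock i (σ i) ≡ specialBlock i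
    starBlock-σ i = ≡.trans (cong (starBlock i) (σ≗starOf i)) (starBlock-starOf i)

module Bijection {ℓ : Level} (S : ℕ → Set ℓ) (n k r : ℕ) where
  lookup-partition : ∀ (stars : Vec (AsteriskList n) r) A →
    LabelPartition (Vec.toList stars) A → LabelPartition (map (Vec.lookup stars) (allFin r)) A
  lookup-partition stars A = subst (λ ts → LabelPartition ts A) (toList≡map-lookup-allFin stars)

  to : LPart S r n k → Pairs S r n k
  to (lpart B count sizes partition canonical separated) =
    pair (Vec.tabulate starOf) plainBlocks
      (VAllP.tabulate⁺ (Valid.stars-sizes partition canonical separated S sizes))
      (Valid.plainBlocks-count partition canonical separated count)
      (plainBlocks-sizes S sizes)
      (subst (λ ts → LabelPartition ts plainBlocks) (sym (toList-tabulate starOf))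
             (Valid.stars-partition partition canonical separated))
      (Valid.plainBlocks-canonical partition canonical separated)
    where open FromPartition n r B

  from : Pairs S r n k → LPart S r n k
  from (pair stars A starSizes count sizes partition canonical) =
    lpart blocks
      (≡.trans blocks-count (cong (_+ r) count))
      (blocks-sizes S (VAllP.lookup⁺ starSizes) sizes)
      (Valid.blocks-partition (lookup-partition stars A partition)
                              (All.map proj₁ sizes))
      (Valid.blocks-canonical (lookup-partition stars A partition)
                              (All.map proj₁ sizes))
      blocks-separated
    where open FromPairs n r (Vec.lookup stars) A

  Pairs-≡ : ∀ (x y : Pairs S r n k) → Pairs.stars x ≡ Pairs.stars y → Pairs.blocks x ≡ Pairs.blocks y →
    x ≡ y
  Pairs-≡ (pair _ _ _ _ _ _ _) (pair _ _ _ _ _ _ _) refl refl = refl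

  LPart-≡ : ∀ (x y : LPart S r n k) → LPart.blocks x ≡ LPart.blocks y → x ≡ y
  LPart-≡ (lpart _ _ _ _ _ _) (lpart _ _ _ _ _ _) refl = refl

  _≟ᴸ_ : ∀ {m} (x y : List (List (Fin m))) → Dec (x ≡ y)
  _≟ᴸ_ = LP.≡-dec (LP.≡-dec FinP._≟_)

  _≟ˢ_ : (x y : Vec (AsteriskList n) r) → Dec (x ≡ y)
  _≟ˢ_ = VecP.≡-dec (ProdP.≡-dec (LP.≡-dec FinP._≟_) (LP.≡-dec FinP._≟_))

  -- The round-trip equations are derived from the irrelevant validity fields,
  -- so they are rebuilt relevantly by deciding them.
  to∘from : ∀ y → to (from y) ≡ y
  to∘from y@(pair stars A _ _ sizes partition canonical) = Pairs-≡ (to (from y)) y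
    (recompute (_ ≟ˢ _) (≡.trans
      (VecP.tabulate-cong (starOf-blocks (lookup-partition stars A partition) (All.map proj₁ sizes) canonical))
      (VecP.tabulate∘lookup stars)))
    (recompute (_ ≟ᴸ _) (plainBlocks-blocks (lookup-partition stars A partition) (All.map proj₁ sizes) canonical))
    where open PairsRoundTrip n r (Vec.lookup stars) A

  from∘to : ∀ x → from (to x) ≡ x
  from∘to x@(lpart B _ sizes partition canonical separated) = LPart-≡ (from (to x)) x
    (recompute (_ ≟ᴸ _) (blocks-starOf partition canonical separated (All.map proj₁ sizes)
                          (Vec.lookup (Vec.tabulate starOf)) (VecP.lookup∘tabulate starOf)))
    where
    open FromPartition n r B using (starOf)
    open PartitionRoundTrip n r B using (blocks-starOf)

mainTheorem9 : {ℓ : Level} (S : ℕ → Set ℓ) → (∀ {s} → S s → 0 < s) →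
    (n k r : ℕ) → LPart S r n k ↔ Pairs S r n k
mainTheorem9 S _ n k r = mk↔ₛ′ to from to∘from from∘to
  where open Bijection S n k r
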